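{- Let $G$ be a simple subcubic graph and let $V(K_2)=\{a,b\}$. Let $e_a=(u,a)(v,a)$, where $uv\in E(G)$, and $f=(w,a)(w,b)$, where $w\in V(G)$ (possibly $w\in\{u,v\}$), be two edges of $G\square K_2$. Then any proper partial edge-coloring of $\{e_a,f\}$ with colors from a set of four colors extends to a proper $4$-edge-coloring of $G\square K_2$.
   Context: A graph is subcubic if its maximum degree is at most $3$. A proper partial edge-coloring assigns colors to some edges so that adjacent colored edges get distinct colors. The Cartesian product $G\square H$ has vertex set $V(G)\times V(H)$, with $(u_1,u_2)\sim(v_1,v_2)$ iff either $u_1=v_1$ and $u_2v_2\in E(H)$, or $u_2=v_2$ and $u_1v_1\in E(G)$. -}

module Defs where

open import Data.Nat using (ℕ; _≤_)
open import Data.Fin using (Fin; zero; suc)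
open import Data.Fin.Properties using (_≟_)
open import Data.Bool using (Bool; true; false; T; _∧_; _∨_; if_then_else_)
open import Data.List using (map; allFin)
open import Data.Nat.ListAction using (sum)
open import Data.Product using (_×_; _,_; proj₁; proj₂)
open import Data.Maybe using (Maybe; just; nothing)
open import Relation.Binary.PropositionalEquality using (_≡_; _≢_)
open import Relation.Nullary.Decidable using (⌊_⌋)

record Graph (n : ℕ) : Set where
  field
    adj   : Fin n → Fin n → Bool
    sym   : ∀ x y → adj x y ≡ adj y x
    irref : ∀ x → adj x x ≡ false
open Graph public

Adj : ∀ {n} → Graph n → Fin n → Fin n → Set
Adj G x y = T (adj G x y)

degree : ∀ {n} → Graph n → Fin n → ℕ
degree {n} G v = sum (map (λ x → if adj G v x then 1 else 0) (allFin n))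

Subcubic : ∀ {n} → Graph n → Set
Subcubic G = ∀ v → degree G v ≤ 3

a b : Fin 2
a = zero
b = suc zero

K₂adj : Fin 2 → Fin 2 → Bool
K₂adj x y = Data.Bool.not ⌊ x ≟ y ⌋

□K₂adj : ∀ {n} → Graph n → Fin n × Fin 2 → Fin n × Fin 2 → Bool
□K₂adj G (u₁ , u₂) (v₁ , v₂) =
  (⌊ u₁ ≟ v₁ ⌋ ∧ K₂adj u₂ v₂) ∨ (⌊ u₂ ≟ v₂ ⌋ ∧ adj G u₁ v₁)

-- A proper k-edge-colouring of a graph given by adjacency E on vertex type V:
-- c assigns to every edge xy (as an unordered pair, i.e. c x y = c y x)
-- a colour in Fin k, and edges sharing an endpoint get distinct colours.
-- (Values of c on non-adjacent pairs are irrelevant.)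
IsProperEdgeColouring : {V : Set} → (V → V → Bool) → (k : ℕ) → (V → V → Fin k) → Set
IsProperEdgeColouring {V} E k c =
  (∀ x y → T (E x y) → c x y ≡ c y x) ×
  (∀ x y z → T (E x y) → T (E x z) → y ≢ z → c x y ≢ c x z)

-- It suffices to colour G with four colours so that uv gets colour i and no
-- edge at w gets colour j: copying such a colouring onto both layers and giving
-- each rung (x, a)(x, b) a colour missing at x in G (j at w) colours G □ K₂
-- properly.  That colouring of G is built vertex by vertex, starting from
-- {u, v, w}.  A new vertex z has at most three coloured neighbours, each of
-- which misses at least two colours (only w, which must also avoid j, may miss
-- just one), so the edges at z can be coloured from these lists unless all of
-- them lie in a common pair; then a single Kempe change, in two colours other
-- than j, frees a colour.  Since j is never recoloured, only the j-coloured
-- edges are controlled during the construction (none at w, and uv among them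
-- exactly when i ≡ j); a final renaming of colours gives uv the colour i.
module Submission where

open import Defs hiding (sym)
open import Data.Nat as ℕ using (ℕ; zero; suc; _+_; _≤_; _<_; z≤n; s≤s; s≤s⁻¹)
open import Data.Nat.Properties
  using (≤-refl; ≤-trans; <⇒≤; m≤n⇒m<n∨m≡n; n<1+n; ≰⇒>; ≤-antisym; module ≤-Reasoning)
open import Data.Nat.ListAction using (sum)
open import Data.Bool using (Bool; true; false; T; _∧_; if_then_else_)
open import Data.Bool.Properties using (T-∨; T-∧)
open import Data.Unit using (⊤; tt)
open import Data.Empty using (⊥; ⊥-elim)
open import Data.Fin as Fin using (Fin; toℕ; fromℕ<)
open import Data.Fin.Patterns using (0F; 1F; 2F)
open import Data.Fin.Properties
  using (_≟_; any?; all?; pigeonhole; toℕ-injective; toℕ-fromℕ<; toℕ≤pred[n]; <⇒≢)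
open import Data.Fin.Permutation.Components using (transpose)
open import Data.Fin.Subset using (Subset; ⁅_⁆; _∪_; _⊆_) renaming (_∈_ to _∈ₛ_; _∉_ to _∉ₛ_)
open import Data.Fin.Subset.Properties
  using (_∈?_; x∈p∪q⁻; x∈p∪q⁺; p⊆p∪q; q⊆p∪q; x∈⁅x⁆; x∈⁅y⁆⇒x≡y)
open import Data.List using (List; []; _∷_; length; map; filter; allFin; head; drop; lookup)
open import Data.List.Properties using (length-filter; filter-notAll; length-map)
open import Data.List.Membership.Propositional using (_∈_; _∉_)
open import Data.List.Membership.Propositional.Properties using (∈-filter⁺; ∈-filter⁻; ∈-map⁺; ∈-allFin)
open import Data.List.Relation.Unary.All as All using ()
open import Data.List.Relation.Unary.AllPairs using (_∷_)
open import Data.List.Relation.Unary.Any as Any using (here; there)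
open import Data.List.Relation.Unary.Any.Properties using (lookup-index)
open import Data.List.Relation.Unary.Unique.Propositional using (Unique)
open import Data.List.Relation.Unary.Unique.Propositional.Properties using (allFin⁺; filter⁺)
open import Data.Maybe using (Maybe; just; nothing; _>>=_)
open import Data.Maybe.Properties using (just-injective) renaming (≡-dec to ≡-dec-Maybe)
open import Data.Product using (Σ; ∃; ∃₂; _×_; _,_; proj₁; proj₂; map₂)
open import Data.Sum using (_⊎_; inj₁; inj₂; swap)
open import Function using (_∘_; id; case_of_; _⇔_; mk⇔; Equivalence)
open import Function.Properties.Equivalence using () renaming (trans to ⇔-trans)
open import Relation.Binary.PropositionalEquality
open import Relation.Nullary using (Dec; yes; no; ¬_; contradiction)
open import Relation.Nullary.Decidable
  using (⌊_⌋; T?; ¬?; _×-dec_; _→-dec_; map′; dec-true; dec-false; decidable-stable; toWitness; toWitnessFalse)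

open Equivalence using (to; from)

private variable
  A : Set
  m n : ℕ

transpose-matchˡ : (a b : Fin n) → transpose a b a ≡ b
transpose-matchˡ a b rewrite dec-true (a ≟ a) refl = refl

transpose-matchʳ : (a b : Fin n) → transpose a b b ≡ a
transpose-matchʳ a b with b ≟ a
... | yes b≡a = b≡a
... | no _ rewrite dec-true (b ≟ b) refl = refl

transpose-other : {a b c : Fin n} → c ≢ a → c ≢ b → transpose a b c ≡ c
transpose-other {a = a} {b} {c} c≢a c≢b rewrite dec-false (c ≟ a) c≢a | dec-false (c ≟ b) c≢b = refl

transpose-involutive : (a b c : Fin n) → transpose a b (transpose a b c) ≡ c
transpose-involutive a b c = by-cases a b c (c ≟ a) (c ≟ b)
  where
  by-cases : (a b c : Fin n) → Dec (c ≡ a) → Dec (c ≡ b) → transpose a b (transpose a b c) ≡ c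
  by-cases a b _ (yes refl) _ = trans (cong (transpose a b) (transpose-matchˡ a b)) (transpose-matchʳ a b)
  by-cases a b _ (no _) (yes refl) = trans (cong (transpose a b) (transpose-matchʳ a b)) (transpose-matchˡ a b)
  by-cases a b c (no c≢a) (no c≢b) =
    trans (cong (transpose a b) (transpose-other c≢a c≢b)) (transpose-other c≢a c≢b)

transpose-injective : (a b : Fin n) {c d : Fin n} → transpose a b c ≡ transpose a b d → c ≡ d
transpose-injective a b {c} {d} eq = begin
  c                                 ≡⟨ transpose-involutive a b c ⟨
  transpose a b (transpose a b c)   ≡⟨ cong (transpose a b) eq ⟩
  transpose a b (transpose a b d)   ≡⟨ transpose-involutive a b d ⟩
  d                                 ∎
  where open ≡-Reasoning

transpose-≡-other : {a b c : Fin n} → c ≢ a → c ≢ b → (d : Fin n) → transpose a b d ≡ c ⇔ d ≡ c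
transpose-≡-other c≢a c≢b d = mk⇔
  (λ eq → transpose-injective _ _ (trans eq (sym (transpose-other c≢a c≢b))))
  (λ { refl → transpose-other c≢a c≢b })

∃-∉ : (cs : List (Fin m)) → length cs < m → ∃ λ c → c ∉ cs
∃-∉ cs short with any? (λ c → ¬? (Any.any? (c ≟_) cs))
... | yes found = found
... | no none = contradiction (pigeonhole short (Any.index ∘ everywhere)) distinct
  where
  everywhere : ∀ c → c ∈ cs
  everywhere c = decidable-stable (Any.any? (c ≟_) cs) (λ c∉cs → none (c , c∉cs))
  distinct : ¬ ∃₂ λ c d → c Fin.< d × Any.index (everywhere c) ≡ Any.index (everywhere d)
  distinct (c , d , c<d , same) = <⇒≢ c<d (begin
    c                                    ≡⟨ lookup-index (everywhere c) ⟩
    lookup cs (Any.index (everywhere c)) ≡⟨ cong (lookup cs) same ⟩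
    lookup cs (Any.index (everywhere d)) ≡⟨ lookup-index (everywhere d) ⟨
    d                                    ∎)
    where open ≡-Reasoning

∃₂-∉ : (cs : List (Fin m)) → 2 + length cs ≤ m → ∃₂ λ c c' → c ≢ c' × c ∉ cs × c' ∉ cs
∃₂-∉ cs short with ∃-∉ cs (<⇒≤ short)
... | c , c∉cs with ∃-∉ (c ∷ cs) short
...   | c' , c'∉c∷cs = c , c' , (λ c≡c' → c'∉c∷cs (here (sym c≡c'))) , c∉cs , c'∉c∷cs ∘ there

no-three-distinct : {x y p q r : A} → p ≡ x ⊎ p ≡ y → q ≡ x ⊎ q ≡ y → r ≡ x ⊎ r ≡ y →
                    p ≢ q → p ≢ r → q ≢ r → ⊥
no-three-distinct (inj₁ refl) (inj₁ refl) _ p≢q _ _ = p≢q refl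
no-three-distinct (inj₂ refl) (inj₂ refl) _ p≢q _ _ = p≢q refl
no-three-distinct (inj₁ refl) (inj₂ refl) (inj₁ refl) _ p≢r _ = p≢r refl
no-three-distinct (inj₁ refl) (inj₂ refl) (inj₂ refl) _ _ q≢r = q≢r refl
no-three-distinct (inj₂ refl) (inj₁ refl) (inj₂ refl) _ p≢r _ = p≢r refl
no-three-distinct (inj₂ refl) (inj₁ refl) (inj₁ refl) _ _ q≢r = q≢r refl

>>=-just : {A B : Set} (m : Maybe A) {f : A → Maybe B} {y : B} →
           (m >>= f) ≡ just y → ∃ λ x → m ≡ just x × f x ≡ just y
>>=-just (just x) eq = x , refl , eq

record IsProper {V C : Set} (E : V → V → Set) (φ : V → V → C) : Set where
  field
    symmetric : ∀ {p q} → E p q → φ p q ≡ φ q p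
    distinct  : ∀ {p q r} → E p q → E p r → q ≢ r → φ p q ≢ φ p r

Misses : {V C : Set} → (V → V → Set) → (V → V → C) → V → C → Set
Misses E φ p c = ∀ q → E p q → φ p q ≢ c

module KempeChain {n k} {E : Fin n → Fin n → Set} (E? : ∀ p q → Dec (E p q))
  (E-sym : ∀ {p q} → E p q → E q p) (E-irrefl : ∀ {p} → ¬ E p p)
  {φ : Fin n → Fin n → Fin k} (φ-proper : IsProper E φ)
  {a b : Fin k} (a≢b : a ≢ b) {x : Fin n} (x-misses-a : Misses E φ x a) where

  open IsProper φ-proper

  private variable
    p q r : Fin n
    c : Fin k
    s t t' : ℕ

  same-colour⇒same-end : E p q → E p r → φ p q ≡ φ p r → q ≡ r
  same-colour⇒same-end {q = q} {r} Epq Epr eq with q ≟ r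
  ... | yes q≡r = q≡r
  ... | no q≢r = contradiction eq (distinct Epq Epr q≢r)

  Step : Fin n → Fin k → Fin n → Set
  Step p c q = E p q × φ p q ≡ c

  step : Fin n → Fin k → Maybe (Fin n)
  step p c with any? (λ q → E? p q ×-dec (φ p q ≟ c))
  ... | yes (q , _) = just q
  ... | no _ = nothing

  step-sound : step p c ≡ just q → Step p c q
  step-sound {p} {c} eq with any? (λ q → E? p q ×-dec (φ p q ≟ c))
  step-sound refl | yes (_ , found) = found

  step-complete : Step p c q → step p c ≡ just q
  step-complete {p} {c} (Epq , φpq) with any? (λ q → E? p q ×-dec (φ p q ≟ c))
  ... | yes (_ , Epq' , φpq') = cong just (same-colour⇒same-end Epq' Epq (trans φpq' (sym φpq)))
  ... | no none = contradiction (_ , Epq , φpq) none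

  -- x has no a-edge, so the chain leaves x along b.
  colour : ℕ → Fin k
  colour zero = b
  colour (suc zero) = a
  colour (suc (suc t)) = colour t

  colour-a-or-b : ∀ t → colour t ≡ a ⊎ colour t ≡ b
  colour-a-or-b zero = inj₂ refl
  colour-a-or-b (suc zero) = inj₁ refl
  colour-a-or-b (suc (suc t)) = colour-a-or-b t

  colour-alternates : ∀ t → colour (suc t) ≢ colour t
  colour-alternates zero = a≢b
  colour-alternates (suc zero) = a≢b ∘ sym
  colour-alternates (suc (suc t)) = colour-alternates t

  a-or-b⇒colour : ∀ t → c ≡ a ⊎ c ≡ b → c ≡ colour t ⊎ c ≡ colour (suc t)
  a-or-b⇒colour zero = swap
  a-or-b⇒colour (suc t) = swap ∘ a-or-b⇒colour t

  colour≢a⇒≡b : ∀ t → colour t ≢ a → colour t ≡ b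
  colour≢a⇒≡b t ≢a with colour-a-or-b t
  ... | inj₁ ≡a = contradiction ≡a ≢a
  ... | inj₂ ≡b = ≡b

  colour≡b⇒next≡a : ∀ t → colour t ≡ b → colour (suc t) ≡ a
  colour≡b⇒next≡a t ≡b with colour-a-or-b (suc t)
  ... | inj₁ ≡a = ≡a
  ... | inj₂ next≡b = contradiction (trans next≡b (sym ≡b)) (colour-alternates t)

  walk : ℕ → Maybe (Fin n)
  walk zero = just x
  walk (suc t) = walk t >>= λ p → step p (colour t)

  record At (t : ℕ) (p : Fin n) : Set where
    constructor reached
    field walk≡ : walk t ≡ just p

  At-functional : At t p → At t q → p ≡ q
  At-functional (reached e) (reached e') = just-injective (trans (sym e) e')

  walk-suc⁺ : At t p → Step p (colour t) q → At (suc t) q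
  walk-suc⁺ {t} (reached e) s = reached (trans (cong (_>>= λ p → step p (colour t)) e) (step-complete s))

  walk-suc⁻ : At (suc t) q → ∃ λ p → At t p × Step p (colour t) q
  walk-suc⁻ {t} (reached e) with >>=-just (walk t) e
  ... | p , e₁ , e₂ = p , reached e₁ , step-sound e₂

  walk-defined : t ≤ t' → At t' q → ∃ (At t)
  walk-defined {t' = zero} z≤n at = _ , at
  walk-defined {t' = suc t'} t≤t' at with m≤n⇒m<n∨m≡n t≤t'
  ... | inj₂ refl = _ , at
  ... | inj₁ (s≤s t≤t') = walk-defined t≤t' (proj₁ (proj₂ (walk-suc⁻ at)))

  -- Induction on t: if the two visits are entered along edges of the same
  -- colour, properness gives an earlier repetition; otherwise the walk has
  -- just stepped back along the edge it came from.
  no-repeat : s < t → At s p → At t p → ⊥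
  no-repeat {zero} {suc t} _ (reached refl) at-t with walk-suc⁻ at-t
  no-repeat {zero} {suc zero} _ (reached refl) _ | _ , reached refl , Exx , _ = E-irrefl Exx
  no-repeat {zero} {suc (suc zero)} _ (reached refl) _ | r , _ , Erx , φrx≡a =
    x-misses-a r (E-sym Erx) (trans (symmetric (E-sym Erx)) φrx≡a)
  no-repeat {zero} {suc (suc (suc t))} _ (reached refl) _ | r , at-r , Erx , φrx =
    no-repeat (s≤s (s≤s z≤n)) (walk-suc⁺ (reached refl) (E-sym Erx , φxr≡b)) at-r
    where
    φxr≡colour : φ x r ≡ colour t
    φxr≡colour = trans (symmetric (E-sym Erx)) φrx
    φxr≡b : φ x r ≡ b
    φxr≡b = trans φxr≡colour (colour≢a⇒≡b t λ ≡a → x-misses-a r (E-sym Erx) (trans φxr≡colour ≡a))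
  no-repeat {suc s} {suc t} {p} (s≤s s<t) at-s at-t
    with walk-suc⁻ at-s | walk-suc⁻ at-t | a-or-b⇒colour s (colour-a-or-b t)
  ... | r , at-r , Erp , φrp | r' , at-r' , Er'p , φr'p | inj₁ same =
    no-repeat s<t at-r (subst (At t) (same-colour⇒same-end (E-sym Er'p) (E-sym Erp) φpr'≡φpr) at-r')
    where
    φpr'≡φpr : φ p r' ≡ φ p r
    φpr'≡φpr = trans (symmetric (E-sym Er'p)) (trans φr'p (trans same (trans (sym φrp) (symmetric Erp))))
  ... | r , at-r , Erp , φrp | r' , at-r' , Er'p , φr'p | inj₂ next with m≤n⇒m<n∨m≡n s<t
  ...   | inj₂ refl = E-irrefl (subst (λ y → E y p) (At-functional at-r' at-s) Er'p)
  ...   | inj₁ ss≤t with m≤n⇒m<n∨m≡n ss≤t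
  ...     | inj₂ refl = colour-alternates s (sym next)
  ...     | inj₁ ss<t = no-repeat ss<t at-ss at-r'
    where
    at-ss : At (suc (suc s)) r'
    at-ss = walk-suc⁺ at-s (E-sym Er'p , trans (symmetric (E-sym Er'p)) (trans φr'p next))

  walk-ends : walk n ≡ nothing
  walk-ends with walk n in eq
  ... | nothing = refl
  ... | just _ = contradiction (pigeonhole (n<1+n n) (proj₁ ∘ visit)) no-collision
    where
    visit : (t : Fin (suc n)) → ∃ (At (toℕ t))
    visit t = walk-defined (toℕ≤pred[n] t) (reached eq)
    no-collision : ¬ ∃₂ λ s t → s Fin.< t × proj₁ (visit s) ≡ proj₁ (visit t)
    no-collision (s , t , s<t , same) =
      no-repeat s<t (proj₂ (visit s)) (subst (At (toℕ t)) (sym same) (proj₂ (visit t)))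

  before-end : walk t ≡ nothing → At t' q → t' < t
  before-end end at = ≰⇒> λ t≤t' →
    contradiction (trans (sym end) (At.walk≡ (proj₂ (walk-defined t≤t' at)))) λ ()

  InChain : Fin n → Set
  InChain p = ∃ λ t → At t p

  inChain? : ∀ p → Dec (InChain p)
  inChain? p = map′ (λ (t , at) → toℕ t , at) from-time
    (any? λ t → map′ reached At.walk≡ (≡-dec-Maybe _≟_ (walk (toℕ t)) (just p)))
    where
    from-time : InChain p → ∃ λ (t : Fin n) → At (toℕ t) p
    from-time (t , at) =
      fromℕ< t<n , subst (λ t → At t p) (sym (toℕ-fromℕ< t<n)) at
      where
      t<n : t < n
      t<n = before-end walk-ends at

  start-inChain : InChain x
  start-inChain = 0 , reached refl

  inChain-closed : InChain p → E p q → φ p q ≡ a ⊎ φ p q ≡ b → InChain q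
  inChain-closed (t , at) Epq ab with a-or-b⇒colour t ab
  inChain-closed (t , at) Epq ab | inj₁ forward = suc t , walk-suc⁺ at (Epq , forward)
  inChain-closed (zero , reached refl) Epq ab | inj₂ φxq≡a = contradiction φxq≡a (x-misses-a _ Epq)
  inChain-closed {p = p} {q = q} (suc t , at) Epq ab | inj₂ backward with walk-suc⁻ at
  ... | r , at-r , Erp , φrp = t , subst (At t) (same-colour⇒same-end (E-sym Erp) Epq φpr≡φpq) at-r
    where
    φpr≡φpq : φ p r ≡ φ p q
    φpr≡φpq = trans (symmetric (E-sym Erp)) (trans φrp (sym backward))

  -- p is entered along a b-edge, so the walk would have to leave it along an a-edge.
  misses-a⇒last : InChain p → p ≢ x → Misses E φ p a → ∃ λ t → At t p × walk (suc t) ≡ nothing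
  misses-a⇒last (zero , reached refl) p≢x _ = contradiction refl p≢x
  misses-a⇒last {p} (suc t , at) _ p-misses-a with walk-suc⁻ at
  ... | r , _ , Erp , φrp = suc t , at , stuck
    where
    colour≡a : colour (suc t) ≡ a
    colour≡a = colour≡b⇒next≡a t (colour≢a⇒≡b t λ ≡a →
      p-misses-a r (E-sym Erp) (trans (symmetric (E-sym Erp)) (trans φrp ≡a)))
    stuck : walk (suc (suc t)) ≡ nothing
    stuck with walk (suc (suc t)) in eq
    ... | nothing = refl
    ... | just q with walk-suc⁻ (reached eq)
    ...   | p' , at-p' , Ep'q , φp'q with At-functional at-p' at
    ...     | refl = contradiction (trans φp'q colour≡a) (p-misses-a q Ep'q)

  chain-end-unique : ∀ {p p'} → InChain p → InChain p' → p ≢ x → p' ≢ x →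
                     Misses E φ p a → Misses E φ p' a → p ≡ p'
  chain-end-unique p∈ p'∈ p≢x p'≢x p-misses p'-misses
    with misses-a⇒last p∈ p≢x p-misses | misses-a⇒last p'∈ p'≢x p'-misses
  ... | t , at , end | t' , at' , end'
    with ≤-antisym (s≤s⁻¹ (before-end end at')) (s≤s⁻¹ (before-end end' at))
  ...   | refl = At-functional at at'

  kempe : Fin n → Fin n → Fin k
  kempe p q with inChain? p
  ... | yes _ = transpose a b (φ p q)
  ... | no _ = φ p q

  kempe-inside : InChain p → kempe p q ≡ transpose a b (φ p q)
  kempe-inside {p} p∈ with inChain? p
  ... | yes _ = refl
  ... | no p∉ = contradiction p∈ p∉

  kempe-outside : ¬ InChain p → kempe p q ≡ φ p q
  kempe-outside {p} p∉ with inChain? p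
  ... | yes p∈ = contradiction p∈ p∉
  ... | no _ = refl

  kempe-proper : IsProper E kempe
  kempe-proper = record { symmetric = kempe-symmetric ; distinct = kempe-distinct }
    where
    crossing-fixed : InChain p → ¬ InChain q → E p q → transpose a b (φ p q) ≡ φ p q
    crossing-fixed p∈ q∉ Epq =
      transpose-other (q∉ ∘ inChain-closed p∈ Epq ∘ inj₁) (q∉ ∘ inChain-closed p∈ Epq ∘ inj₂)
    kempe-symmetric : E p q → kempe p q ≡ kempe q p
    kempe-symmetric {p} {q} Epq with inChain? p | inChain? q
    ... | yes _ | yes _ = cong (transpose a b) (symmetric Epq)
    ... | no _ | no _ = symmetric Epq
    ... | yes p∈ | no q∉ = trans (crossing-fixed p∈ q∉ Epq) (symmetric Epq)
    ... | no p∉ | yes q∈ = trans (symmetric Epq) (sym (crossing-fixed q∈ p∉ (E-sym Epq)))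
    kempe-distinct : E p q → E p r → q ≢ r → kempe p q ≢ kempe p r
    kempe-distinct {p} Epq Epr q≢r with inChain? p
    ... | yes _ = distinct Epq Epr q≢r ∘ transpose-injective a b
    ... | no _ = distinct Epq Epr q≢r

  kempe-≡-other : c ≢ a → c ≢ b → ∀ p q → kempe p q ≡ c ⇔ φ p q ≡ c
  kempe-≡-other c≢a c≢b p q with inChain? p
  ... | yes _ = transpose-≡-other c≢a c≢b (φ p q)
  ... | no _ = mk⇔ id id

  misses-kempe-inside : InChain p → Misses E φ p c → Misses E kempe p (transpose a b c)
  misses-kempe-inside p∈ misses q Epq eq =
    misses q Epq (transpose-injective a b (trans (sym (kempe-inside p∈)) eq))

  misses-kempe-outside : ¬ InChain p → Misses E φ p c → Misses E kempe p c
  misses-kempe-outside p∉ misses q Epq eq = misses q Epq (trans (sym (kempe-outside p∉)) eq)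

  misses-kempe-other : c ≢ a → c ≢ b → Misses E φ p c → Misses E kempe p c
  misses-kempe-other c≢a c≢b misses q Epq eq =
    misses q Epq (to (kempe-≡-other c≢a c≢b _ q) eq)

  start-misses-b : Misses E kempe x b
  start-misses-b = subst (Misses E kempe x) (transpose-matchˡ a b) (misses-kempe-inside start-inChain x-misses-a)

sum-indicator≡length-filter : (f : A → Bool) (xs : List A) →
  sum (map (λ x → if f x then 1 else 0) xs) ≡ length (filter (T? ∘ f) xs)
sum-indicator≡length-filter f [] = refl
sum-indicator≡length-filter f (x ∷ xs) with f x
... | true = cong suc (sum-indicator≡length-filter f xs)
... | false = sum-indicator≡length-filter f xs

module _ (G : Graph n) where

  Adj-sym : ∀ {p q} → Adj G p q → Adj G q p
  Adj-sym {p} {q} = subst T (Graph.sym G p q)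

  Adj-irrefl : ∀ {p} → ¬ Adj G p p
  Adj-irrefl {p} = subst T (irref G p)

  Adj⇒≢ : ∀ {p q} → Adj G p q → p ≢ q
  Adj⇒≢ Apq refl = Adj-irrefl Apq

  neighbours : Fin n → List (Fin n)
  neighbours p = filter (T? ∘ adj G p) (allFin n)

  ∈-neighbours : ∀ {p q} → q ∈ neighbours p ⇔ Adj G p q
  ∈-neighbours {p} {q} =
    mk⇔ (proj₂ ∘ ∈-filter⁻ (T? ∘ adj G p) {xs = allFin n}) (∈-filter⁺ (T? ∘ adj G p) (∈-allFin q))

  neighbours-unique : ∀ p → Unique (neighbours p)
  neighbours-unique p = filter⁺ (T? ∘ adj G p) (allFin⁺ n)

  length-neighbours : ∀ p → length (neighbours p) ≡ degree G p
  length-neighbours p = sym (sum-indicator≡length-filter (adj G p) (allFin n))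

head-drop-∈ : ∀ m (xs : List A) {y} → head (drop m xs) ≡ just y → y ∈ xs
head-drop-∈ zero (x ∷ xs) refl = here refl
head-drop-∈ (suc m) (x ∷ xs) eq = there (head-drop-∈ m xs eq)

head-drop-injective : ∀ {m m'} {xs : List A} {y} → Unique xs →
  head (drop m xs) ≡ just y → head (drop m' xs) ≡ just y → m ≡ m'
head-drop-injective {m = zero} {zero} _ _ _ = refl
head-drop-injective {m = zero} {suc m'} {x ∷ xs} (x∉xs ∷ _) refl eq' =
  contradiction refl (All.lookup x∉xs (head-drop-∈ m' xs eq'))
head-drop-injective {m = suc m} {zero} {x ∷ xs} (x∉xs ∷ _) eq refl =
  contradiction refl (All.lookup x∉xs (head-drop-∈ m xs eq))
head-drop-injective {m = suc m} {suc m'} {x ∷ xs} (_ ∷ unique) eq eq' =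
  cong suc (head-drop-injective unique eq eq')

slotOf : List A → Fin 3 → Maybe A
slotOf xs k = head (drop (toℕ k) xs)

∈⇒slotOf : {xs : List A} {y : A} → length xs ≤ 3 → y ∈ xs → ∃ λ k → slotOf xs k ≡ just y
∈⇒slotOf {xs = _ ∷ _ ∷ _ ∷ _ ∷ _} (s≤s (s≤s (s≤s ()))) _
∈⇒slotOf _ (here refl) = 0F , refl
∈⇒slotOf _ (there (here refl)) = 1F , refl
∈⇒slotOf _ (there (there (here refl))) = 2F , refl

TwoOf : {C : Set} → (C → Set) → Set
TwoOf {C} P = ∃₂ λ (c c' : C) → c ≢ c' × P c × P c'

DistinctRepresentatives : ∀ {m} {C : Set} → (Fin m → C → Set) → Set
DistinctRepresentatives {m} {C} P =
  Σ (Fin m → C) λ rep → (∀ {k k'} → rep k ≡ rep k' → k ≡ k') × (∀ k → P k (rep k))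

module _ {C : Set} {P : Fin 3 → C → Set} {c₀ c₁ c₂ : C} where

  distinct-triple : c₀ ≢ c₁ → c₀ ≢ c₂ → c₁ ≢ c₂ → P 0F c₀ → P 1F c₁ → P 2F c₂ →
                    DistinctRepresentatives P
  distinct-triple c₀≢c₁ c₀≢c₂ c₁≢c₂ p₀ p₁ p₂ = rep , injective , represents
    where
    rep : Fin 3 → C
    rep 0F = c₀
    rep 1F = c₁
    rep 2F = c₂
    injective : ∀ {k k'} → rep k ≡ rep k' → k ≡ k'
    injective {0F} {0F} _ = refl
    injective {1F} {1F} _ = refl
    injective {2F} {2F} _ = refl
    injective {0F} {1F} e = contradiction e c₀≢c₁
    injective {0F} {2F} e = contradiction e c₀≢c₂
    injective {1F} {2F} e = contradiction e c₁≢c₂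
    injective {1F} {0F} e = contradiction (sym e) c₀≢c₁
    injective {2F} {0F} e = contradiction (sym e) c₀≢c₂
    injective {2F} {1F} e = contradiction (sym e) c₁≢c₂
    represents : ∀ k → P k (rep k)
    represents 0F = p₀
    represents 1F = p₁
    represents 2F = p₂

record Blocked {m} (P : Fin 3 → Fin m → Set) (j : Fin m) : Set where
  field
    α β γ : Fin m
    α≢β : α ≢ β
    γ≢α : γ ≢ α
    γ≢β : γ ≢ β
    α≢j : α ≢ j
    β≢j : β ≢ j
    α∈ : ∀ k → P k α
    γ∈₁ : P 1F γ
    γ∈₂ : P 2F γ
    β∉ : ∀ k → ¬ P k β

module _ {m} {P : Fin 3 → Fin m → Set} (P? : ∀ k c → Dec (P k c)) {j : Fin m} where

  private
    other-than : ∀ {Q : Fin m → Set} c → TwoOf Q → ∃ λ d → Q d × d ≢ c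
    other-than c (d , d' , d≢d' , Qd , Qd') with d ≟ c
    ... | yes refl = d' , Qd' , d≢d' ∘ sym
    ... | no d≢c = d , Qd , d≢c

    within : ∀ {k} c d → ¬ (∃ λ e → P k e × e ≢ c × e ≢ d) → ∀ e → P k e → e ≡ c ⊎ e ≡ d
    within c d none e Pe with e ≟ c | e ≟ d
    ... | yes e≡c | _ = inj₁ e≡c
    ... | no _ | yes e≡d = inj₂ e≡d
    ... | no e≢c | no e≢d = contradiction (e , Pe , e≢c , e≢d) none

    both-of-pair : ∀ {Q : Fin m → Set} {c d} → (∀ e → Q e → e ≡ c ⊎ e ≡ d) → TwoOf Q → Q c × Q d
    both-of-pair pair (e , e' , e≢e' , Qe , Qe') with pair e Qe | pair e' Qe'
    ... | inj₁ refl | inj₁ refl = contradiction refl e≢e'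
    ... | inj₁ refl | inj₂ refl = Qe , Qe'
    ... | inj₂ refl | inj₁ refl = Qe' , Qe
    ... | inj₂ refl | inj₂ refl = contradiction refl e≢e'

    avoiding : ∀ k c d → Dec (∃ λ e → P k e × e ≢ c × e ≢ d)
    avoiding k c d = any? λ e → P? k e ×-dec ¬? (e ≟ c) ×-dec ¬? (e ≟ d)

  -- Hall's condition can only fail on all three lists together, when they
  -- lie inside a common pair {α, γ}.
  representatives-or-blocked : 3 < m → (∃ λ c → c ≢ j × P 0F c) → TwoOf (P 1F) → TwoOf (P 2F) →
                               DistinctRepresentatives P ⊎ Blocked P j
  representatives-or-blocked 3<m (c , c≢j , P₀c) two₁ two₂ with other-than c two₂
  ... | d , P₂d , d≢c with avoiding 1F c d
  ...   | yes (e , P₁e , e≢c , e≢d) =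
    inj₁ (distinct-triple {P = P} (e≢c ∘ sym) (d≢c ∘ sym) e≢d P₀c P₁e P₂d)
  ...   | no none₁ with both-of-pair (within c d none₁) two₁ | avoiding 2F c d
  ...     | P₁c , P₁d | yes (e , P₂e , e≢c , e≢d) =
    inj₁ (distinct-triple {P = P} (d≢c ∘ sym) (e≢c ∘ sym) (e≢d ∘ sym) P₀c P₁d P₂e)
  ...     | P₁c , P₁d | no none₂ with both-of-pair (within c d none₂) two₂ | ∃-∉ (c ∷ d ∷ j ∷ []) 3<m
  ...       | P₂c , _ | b , b∉ with P? 0F b
  ...         | yes P₀b =
    inj₁ (distinct-triple {P = P} (b∉ ∘ here) (b∉ ∘ there ∘ here) (d≢c ∘ sym) P₀b P₁c P₂d)
  ...         | no ¬P₀b = inj₂ record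
    { α = c ; β = b ; γ = d
    ; α≢β = b∉ ∘ here ∘ sym ; γ≢α = d≢c ; γ≢β = b∉ ∘ there ∘ here ∘ sym
    ; α≢j = c≢j ; β≢j = b∉ ∘ there ∘ there ∘ here
    ; α∈ = λ { 0F → P₀c ; 1F → P₁c ; 2F → P₂c }
    ; γ∈₁ = P₁d ; γ∈₂ = P₂d
    ; β∉ = λ { 0F → ¬P₀b ; 1F → b-outside (within c d none₁ b) ; 2F → b-outside (within c d none₂ b) }
    }
    where
    b-outside : ∀ {X : Set} → (X → b ≡ c ⊎ b ≡ d) → ¬ X
    b-outside pair x with pair x
    ... | inj₁ b≡c = b∉ (here b≡c)
    ... | inj₂ b≡d = b∉ (there (here b≡d))

Colour : Set
Colour = Fin 4

module Construction {n} (G : Graph n) (subcubic : Subcubic G)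
  {u v : Fin n} (uv : Adj G u v) (w : Fin n) {i j : Colour} (i≢j-at-w : w ≡ u ⊎ w ≡ v → i ≢ j) where

  private variable
    p q r y : Fin n
    S S' : Subset n
    φ : Fin n → Fin n → Colour

  Edge : Subset n → Fin n → Fin n → Set
  Edge S p q = Adj G p q × p ∈ₛ S × q ∈ₛ S

  Edge? : ∀ S p q → Dec (Edge S p q)
  Edge? S p q = T? (adj G p q) ×-dec p ∈? S ×-dec q ∈? S

  Edge-sym : Edge S p q → Edge S q p
  Edge-sym (Apq , p∈S , q∈S) = Adj-sym G Apq , q∈S , p∈S

  Edge-irrefl : ¬ Edge S p p
  Edge-irrefl (App , _) = Adj-irrefl G App

  record Admissible (S : Subset n) (φ : Fin n → Fin n → Colour) : Set where
    field
      proper : IsProper (Edge S) φ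
      w-misses-j : Misses (Edge S) φ w j
      uv≡j⇔i≡j : φ u v ≡ j ⇔ i ≡ j

  admissible-⊆ : S' ⊆ S → Admissible S φ → Admissible S' φ
  admissible-⊆ S'⊆S adm = record
    { proper = record
      { symmetric = symmetric ∘ restrict
      ; distinct = λ Epq Epr → distinct (restrict Epq) (restrict Epr)
      }
    ; w-misses-j = λ q → w-misses-j q ∘ restrict
    ; uv≡j⇔i≡j = uv≡j⇔i≡j
    }
    where
    open Admissible adm
    open IsProper proper
    restrict : Edge _ p q → Edge _ p q
    restrict (Apq , p∈ , q∈) = Apq , S'⊆S p∈ , S'⊆S q∈

  S₀ : Subset n
  S₀ = ⁅ u ⁆ ∪ (⁅ v ⁆ ∪ ⁅ w ⁆)

  u∈S₀ : u ∈ₛ S₀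
  u∈S₀ = x∈p∪q⁺ (inj₁ (x∈⁅x⁆ u))

  v∈S₀ : v ∈ₛ S₀
  v∈S₀ = x∈p∪q⁺ (inj₂ (x∈p∪q⁺ (inj₁ (x∈⁅x⁆ v))))

  w∈S₀ : w ∈ₛ S₀
  w∈S₀ = x∈p∪q⁺ (inj₂ (x∈p∪q⁺ (inj₂ (x∈⁅x⁆ w))))

  ∈S₀ : p ∈ₛ S₀ → p ≢ w → p ≡ u ⊎ p ≡ v
  ∈S₀ p∈ p≢w with x∈p∪q⁻ ⁅ u ⁆ _ p∈
  ... | inj₁ p∈u = inj₁ (x∈⁅y⁆⇒x≡y u p∈u)
  ... | inj₂ p∈vw with x∈p∪q⁻ ⁅ v ⁆ ⁅ w ⁆ p∈vw
  ...   | inj₁ p∈v = inj₂ (x∈⁅y⁆⇒x≡y v p∈v)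
  ...   | inj₂ p∈w = contradiction (x∈⁅y⁆⇒x≡y w p∈w) p≢w

  -- On {u, v, w}: uv gets i, and the (at most two) edges at w get two
  -- further colours different from i and j.
  module Base {cᵤ cᵥ : Colour} (cᵤ≢cᵥ : cᵤ ≢ cᵥ)
    (cᵤ∉ : cᵤ ∉ i ∷ j ∷ []) (cᵥ∉ : cᵥ ∉ i ∷ j ∷ []) where

    towards-w : Fin n → Colour
    towards-w y with y ≟ u
    ... | yes _ = cᵤ
    ... | no _ = cᵥ

    towards-w∉ : ∀ y → towards-w y ∉ i ∷ j ∷ []
    towards-w∉ y with y ≟ u
    ... | yes _ = cᵤ∉
    ... | no _ = cᵥ∉

    towards-w-injective : ∀ {y y'} → y ≡ u ⊎ y ≡ v → y' ≡ u ⊎ y' ≡ v → y ≢ y' →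
                          towards-w y ≢ towards-w y'
    towards-w-injective {y} {y'} y-uv y'-uv y≢y' with y ≟ u | y' ≟ u
    ... | yes refl | yes refl = contradiction refl y≢y'
    ... | yes _ | no _ = cᵤ≢cᵥ
    ... | no _ | yes _ = cᵤ≢cᵥ ∘ sym
    ... | no y≢u | no y'≢u = contradiction (trans (only-v y-uv y≢u) (sym (only-v y'-uv y'≢u))) y≢y'
      where
      only-v : ∀ {x} → x ≡ u ⊎ x ≡ v → x ≢ u → x ≡ v
      only-v (inj₁ x≡u) x≢u = contradiction x≡u x≢u
      only-v (inj₂ x≡v) _ = x≡v

    φ₀ : Fin n → Fin n → Colour
    φ₀ p q with p ≟ w | q ≟ w
    ... | yes _ | _ = towards-w q
    ... | no _ | yes _ = towards-w p
    ... | no _ | no _ = i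

    φ₀-symmetric : Edge S₀ p q → φ₀ p q ≡ φ₀ q p
    φ₀-symmetric {p} {q} (Apq , _) with p ≟ w | q ≟ w
    ... | yes refl | yes refl = contradiction refl (Adj⇒≢ G Apq)
    ... | yes _ | no _ = refl
    ... | no _ | yes _ = refl
    ... | no _ | no _ = refl

    φ₀-distinct : Edge S₀ p q → Edge S₀ p r → q ≢ r → φ₀ p q ≢ φ₀ p r
    φ₀-distinct {p} {q} {r} (Apq , p∈ , q∈) (Apr , _ , r∈) q≢r with p ≟ w | q ≟ w | r ≟ w
    ... | yes refl | _ | _ =
      towards-w-injective (∈S₀ q∈ (Adj⇒≢ G Apq ∘ sym)) (∈S₀ r∈ (Adj⇒≢ G Apr ∘ sym)) q≢r
    ... | no _ | yes refl | yes refl = contradiction refl q≢r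
    ... | no _ | yes _ | no _ = towards-w∉ p ∘ here
    ... | no _ | no _ | yes _ = towards-w∉ p ∘ here ∘ sym
    ... | no p≢w | no q≢w | no r≢w =
      ⊥-elim (no-three-distinct (∈S₀ p∈ p≢w) (∈S₀ q∈ q≢w) (∈S₀ r∈ r≢w)
                                (Adj⇒≢ G Apq) (Adj⇒≢ G Apr) q≢r)

    φ₀-w-misses-j : Misses (Edge S₀) φ₀ w j
    φ₀-w-misses-j q _ with w ≟ w
    ... | yes _ = towards-w∉ q ∘ there ∘ here
    ... | no w≢w = contradiction refl w≢w

    φ₀-uv : φ₀ u v ≡ j ⇔ i ≡ j
    φ₀-uv with u ≟ w | v ≟ w
    ... | yes u≡w | _ =
      mk⇔ (⊥-elim ∘ towards-w∉ v ∘ there ∘ here) (⊥-elim ∘ i≢j-at-w (inj₁ (sym u≡w)))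
    ... | no _ | yes v≡w =
      mk⇔ (⊥-elim ∘ towards-w∉ u ∘ there ∘ here) (⊥-elim ∘ i≢j-at-w (inj₂ (sym v≡w)))
    ... | no _ | no _ = mk⇔ id id

    admissible : Admissible S₀ φ₀
    admissible = record
      { proper = record { symmetric = φ₀-symmetric ; distinct = φ₀-distinct }
      ; w-misses-j = φ₀-w-misses-j
      ; uv≡j⇔i≡j = φ₀-uv
      }

  base : ∃ (Admissible S₀)
  base with ∃₂-∉ (i ∷ j ∷ []) ≤-refl
  ... | _ , _ , cᵤ≢cᵥ , cᵤ∉ , cᵥ∉ = _ , Base.admissible cᵤ≢cᵥ cᵤ∉ cᵥ∉

  module Insert {S : Subset n} {z : Fin n} (z∉S : z ∉ₛ S)
    (u∈S : u ∈ₛ S) (v∈S : v ∈ₛ S) (w∈S : w ∈ₛ S) where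

    Available : (Fin n → Fin n → Colour) → Fin n → Colour → Set
    Available φ y c = Misses (Edge S) φ y c × (y ≡ w → c ≢ j)

    AvailableAt : (Fin n → Fin n → Colour) → Maybe (Fin n) → Colour → Set
    AvailableAt φ nothing c = ⊤
    AvailableAt φ (just y) c = Available φ y c

    available? : ∀ φ s c → Dec (AvailableAt φ s c)
    available? φ nothing c = yes tt
    available? φ (just y) c = all? (λ q → Edge? S y q →-dec ¬? (φ y q ≟ c)) ×-dec (y ≟ w →-dec ¬? (c ≟ j))

    ordinary? : ∀ y → Dec (y ∈ₛ S × y ≢ w)
    ordinary? y = y ∈? S ×-dec ¬? (y ≟ w)

    ordinary : List (Fin n)
    ordinary = filter ordinary? (neighbours G z)

    ∈-ordinary : y ∈ ordinary ⇔ (Adj G z y × y ∈ₛ S × y ≢ w)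
    ∈-ordinary = mk⇔
      (λ y∈ → let y∈N , y∈S , y≢w = ∈-filter⁻ ordinary? {xs = neighbours G z} y∈
              in to (∈-neighbours G) y∈N , y∈S , y≢w)
      (λ (Azy , y∈S , y≢w) → ∈-filter⁺ ordinary? (from (∈-neighbours G) Azy) (y∈S , y≢w))

    length-ordinary : length ordinary ≤ length (neighbours G z)
    length-ordinary = length-filter ordinary? (neighbours G z)

    length-ordinary-< : Adj G z w → length ordinary < length (neighbours G z)
    length-ordinary-< Azw = filter-notAll ordinary? (neighbours G z)
      (Any.map (λ { refl (_ , w≢w) → w≢w refl }) (from (∈-neighbours G) Azw))

    degree-z≤3 : length (neighbours G z) ≤ 3
    degree-z≤3 = subst (_≤ 3) (sym (length-neighbours G z)) (subcubic z)

    -- The S-neighbours of z, with w first when present: w is the only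
    -- neighbour that may have just one available colour.
    candidates : List (Fin n)
    candidates with T? (adj G z w)
    ... | yes _ = w ∷ ordinary
    ... | no _ = ordinary

    ∈-candidates : y ∈ candidates ⇔ (Adj G z y × y ∈ₛ S)
    ∈-candidates {y} with T? (adj G z w)
    ... | yes Azw = mk⇔ (λ { (here refl) → Azw , w∈S ; (there y∈) → map₂ proj₁ (to ∈-ordinary y∈) })
                        λ (Azy , y∈S) → case y ≟ w of λ
                          { (yes y≡w) → here y≡w
                          ; (no y≢w) → there (from ∈-ordinary (Azy , y∈S , y≢w)) }
    ... | no ¬Azw = mk⇔ (map₂ proj₁ ∘ to ∈-ordinary)
                        λ (Azy , y∈S) → from ∈-ordinary (Azy , y∈S , λ { refl → ¬Azw Azy })

    candidates-unique : Unique candidates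
    candidates-unique with T? (adj G z w)
    ... | yes _ = All.tabulate (λ y∈ w≡y → proj₂ (proj₂ (to ∈-ordinary y∈)) (sym w≡y)) ∷ ordinary-unique
      where ordinary-unique = filter⁺ ordinary? (neighbours-unique G z)
    ... | no _ = filter⁺ ordinary? (neighbours-unique G z)

    length-candidates : length candidates ≤ 3
    length-candidates with T? (adj G z w)
    ... | yes Azw = ≤-trans (length-ordinary-< Azw) degree-z≤3
    ... | no _ = ≤-trans length-ordinary degree-z≤3

    slot : Fin 3 → Maybe (Fin n)
    slot = slotOf candidates

    slot-sound : ∀ k → slot k ≡ just y → Adj G z y × y ∈ₛ S
    slot-sound k eq = to ∈-candidates (head-drop-∈ (toℕ k) candidates eq)

    slot-complete : Adj G z y → y ∈ₛ S → ∃ λ k → slot k ≡ just y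
    slot-complete Azy y∈S = ∈⇒slotOf length-candidates (from ∈-candidates (Azy , y∈S))

    slot-injective : ∀ {k k'} → slot k ≡ just y → slot k' ≡ just y → k ≡ k'
    slot-injective eq eq' = toℕ-injective (head-drop-injective candidates-unique eq eq')

    w-first : Adj G z w → slot 0F ≡ just w
    w-first Azw with T? (adj G z w)
    ... | yes _ = refl
    ... | no ¬Azw = contradiction Azw ¬Azw

    later-slot-not-w : ∀ k → k ≢ 0F → slot k ≢ just w
    later-slot-not-w k k≢0 eq = k≢0 (slot-injective eq (w-first (proj₁ (slot-sound k eq))))

    coloursAt : (Fin n → Fin n → Colour) → Fin n → List Colour
    coloursAt φ y = map (φ y) (filter (_∈? S) (neighbours G y))

    ∉coloursAt⇒misses : ∀ φ {c} → c ∉ coloursAt φ y → Misses (Edge S) φ y c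
    ∉coloursAt⇒misses {y} φ c∉ q (Ayq , _ , q∈S) refl =
      c∉ (∈-map⁺ (φ y) (∈-filter⁺ (_∈? S) (from (∈-neighbours G) Ayq) q∈S))

    length-coloursAt : ∀ φ → Adj G z y → length (coloursAt φ y) < 3
    length-coloursAt {y} φ Azy = begin-strict
      length (coloursAt φ y)                        ≡⟨ length-map (φ y) (filter (_∈? S) (neighbours G y)) ⟩
      length (filter (_∈? S) (neighbours G y))      <⟨ filter-notAll (_∈? S) _ z-outside ⟩
      length (neighbours G y)                       ≡⟨ length-neighbours G y ⟩
      degree G y                                    ≤⟨ subcubic y ⟩
      3                                             ∎
      where
      open ≤-Reasoning
      z-outside = Any.map (λ { refl → z∉S }) (from (∈-neighbours G) (Adj-sym G Azy))

    first-slot-available : ∀ φ → ∃ λ c → c ≢ j × AvailableAt φ (slot 0F) c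
    first-slot-available φ with slot 0F in eq
    ... | nothing = let c , c∉ = ∃-∉ (j ∷ []) (s≤s (s≤s z≤n)) in c , c∉ ∘ here , tt
    ... | just y =
      let c , c∉ = ∃-∉ (j ∷ coloursAt φ y) (s≤s (length-coloursAt φ (proj₁ (slot-sound 0F eq))))
      in c , c∉ ∘ here , ∉coloursAt⇒misses φ (c∉ ∘ there) , λ _ → c∉ ∘ here

    later-slot-available : ∀ φ k → k ≢ 0F → TwoOf (AvailableAt φ (slot k))
    later-slot-available φ k k≢0 with slot k in eq
    ... | nothing = 0F , 1F , (λ ()) , tt , tt
    ... | just y =
      let c , c' , c≢c' , c∉ , c'∉ =
            ∃₂-∉ (coloursAt φ y) (s≤s (length-coloursAt φ (proj₁ (slot-sound k eq))))
      in c , c' , c≢c' , (∉coloursAt⇒misses φ c∉ , not-w) , (∉coloursAt⇒misses φ c'∉ , not-w)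
      where
      not-w : ∀ {c} → y ≡ w → c ≢ j
      not-w refl = contradiction eq (later-slot-not-w k k≢0)

    extended : (Fin n → Fin n → Colour) → (Fin n → Colour) → Fin n → Fin n → Colour
    extended φ κ p q with p ≟ z | q ≟ z
    ... | yes _ | _ = κ q
    ... | no _ | yes _ = κ p
    ... | no _ | no _ = φ p q

    module _ {φ : Fin n → Fin n → Colour} {κ : Fin n → Colour} (adm : Admissible S φ)
      (κ-available : ∀ {y} → Adj G z y → y ∈ₛ S → Available φ y (κ y))
      (κ-distinct : ∀ {y y'} → Adj G z y → Adj G z y' → y ∈ₛ S → y' ∈ₛ S → y ≢ y' → κ y ≢ κ y')
      where

      open Admissible adm
      open IsProper proper

      old : p ∈ₛ S ∪ ⁅ z ⁆ → p ≢ z → p ∈ₛ S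
      old p∈ p≢z with x∈p∪q⁻ S ⁅ z ⁆ p∈
      ... | inj₁ p∈S = p∈S
      ... | inj₂ p∈z = contradiction (x∈⁅y⁆⇒x≡y z p∈z) p≢z

      old-edge : Edge (S ∪ ⁅ z ⁆) p q → p ≢ z → q ≢ z → Edge S p q
      old-edge (Apq , p∈ , q∈) p≢z q≢z = Apq , old p∈ p≢z , old q∈ q≢z

      new-edge : Edge (S ∪ ⁅ z ⁆) z q → Adj G z q × q ∈ₛ S
      new-edge (Azq , _ , q∈) = Azq , old q∈ (Adj⇒≢ G Azq ∘ sym)

      extended-symmetric : Edge (S ∪ ⁅ z ⁆) p q → extended φ κ p q ≡ extended φ κ q p
      extended-symmetric {p} {q} Epq with p ≟ z | q ≟ z
      ... | yes refl | yes refl = contradiction Epq Edge-irrefl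
      ... | yes _ | no _ = refl
      ... | no _ | yes _ = refl
      ... | no p≢z | no q≢z = symmetric (old-edge Epq p≢z q≢z)

      extended-distinct : Edge (S ∪ ⁅ z ⁆) p q → Edge (S ∪ ⁅ z ⁆) p r → q ≢ r →
                          extended φ κ p q ≢ extended φ κ p r
      extended-distinct {p} {q} {r} Epq Epr q≢r with p ≟ z | q ≟ z | r ≟ z
      ... | yes refl | _ | _ =
        let Azq , q∈S = new-edge Epq ; Azr , r∈S = new-edge Epr in κ-distinct Azq Azr q∈S r∈S q≢r
      ... | no _ | yes refl | yes refl = contradiction refl q≢r
      ... | no p≢z | yes refl | no r≢z =
        let Azp , p∈S = new-edge (Edge-sym Epq) in proj₁ (κ-available Azp p∈S) r (old-edge Epr p≢z r≢z) ∘ sym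
      ... | no p≢z | no q≢z | yes refl =
        let Azp , p∈S = new-edge (Edge-sym Epr) in proj₁ (κ-available Azp p∈S) q (old-edge Epq p≢z q≢z)
      ... | no p≢z | no q≢z | no r≢z = distinct (old-edge Epq p≢z q≢z) (old-edge Epr p≢z r≢z) q≢r

      extended-w-misses-j : Misses (Edge (S ∪ ⁅ z ⁆)) (extended φ κ) w j
      extended-w-misses-j q Ewq with w ≟ z | q ≟ z
      ... | yes refl | _ = contradiction w∈S z∉S
      ... | no _ | yes refl = proj₂ (κ-available (Adj-sym G (proj₁ Ewq)) w∈S) refl
      ... | no w≢z | no q≢z = w-misses-j q (old-edge Ewq w≢z q≢z)

      extended-uv : extended φ κ u v ≡ j ⇔ i ≡ j
      extended-uv with u ≟ z | v ≟ z
      ... | yes refl | _ = contradiction u∈S z∉S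
      ... | no _ | yes refl = contradiction v∈S z∉S
      ... | no _ | no _ = uv≡j⇔i≡j

      extended-admissible : Admissible (S ∪ ⁅ z ⁆) (extended φ κ)
      extended-admissible = record
        { proper = record { symmetric = extended-symmetric ; distinct = extended-distinct }
        ; w-misses-j = extended-w-misses-j
        ; uv≡j⇔i≡j = extended-uv
        }

    starColour : (Fin 3 → Colour) → Fin n → Colour
    starColour rep y with any? (λ k → ≡-dec-Maybe _≟_ (slot k) (just y))
    ... | yes (k , _) = rep k
    ... | no _ = rep 0F

    starColour-slot : ∀ rep {k} → slot k ≡ just y → starColour rep y ≡ rep k
    starColour-slot {y} rep {k} eq with any? (λ k → ≡-dec-Maybe _≟_ (slot k) (just y))
    ... | yes (k' , eq') = cong rep (slot-injective eq' eq)
    ... | no none = contradiction (k , eq) none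

    extend-by-representatives : Admissible S φ → DistinctRepresentatives (AvailableAt φ ∘ slot) →
                                ∃ (Admissible (S ∪ ⁅ z ⁆))
    extend-by-representatives {φ} adm (rep , rep-injective , rep-available) =
      _ , extended-admissible adm κ-available κ-distinct
      where
      κ-available : Adj G z y → y ∈ₛ S → Available φ y (starColour rep y)
      κ-available {y} Azy y∈S with slot-complete Azy y∈S
      ... | k , eq rewrite starColour-slot rep eq = subst (λ s → AvailableAt φ s (rep k)) eq (rep-available k)
      κ-distinct : ∀ {y y'} → Adj G z y → Adj G z y' → y ∈ₛ S → y' ∈ₛ S → y ≢ y' →
                   starColour rep y ≢ starColour rep y'
      κ-distinct Azy Azy' y∈S y'∈S y≢y' same with slot-complete Azy y∈S | slot-complete Azy' y'∈S
      ... | k , eq | k' , eq'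
        with rep-injective {k} {k'} (trans (sym (starColour-slot rep eq)) (trans same (starColour-slot rep eq')))
      ...   | refl = y≢y' (just-injective (trans (sym eq) eq'))

    occupied : ∀ {φ c} k → ¬ AvailableAt φ (slot k) c → ∃ λ y → slot k ≡ just y
    occupied k unavailable with slot k
    ... | nothing = contradiction tt unavailable
    ... | just y = y , refl

    -- A Kempe change along the (α, β)-chain from the first slot vertex frees β
    -- there.  The other two slot vertices miss α, so only one of them can lie
    -- on the chain, as its far end.
    unblock : Admissible S φ → Blocked (AvailableAt φ ∘ slot) j →
              ∃ λ φ' → Admissible S φ' × DistinctRepresentatives (AvailableAt φ' ∘ slot)
    unblock {φ} adm blocked with occupied 0F (β∉ 0F) | occupied 1F (β∉ 1F) | occupied 2F (β∉ 2F)
      where open Blocked blocked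
    ... | x₀ , eq₀ | x₁ , eq₁ | x₂ , eq₂ = kempe , kempe-admissible , representatives (inChain? x₁)
      where
      open Blocked blocked
      open Admissible adm

      at : ∀ {φ} k {y c} → slot k ≡ just y → AvailableAt φ (slot k) c → Available φ y c
      at {φ} k {c = c} eq = subst (λ s → AvailableAt φ s c) eq

      back : ∀ {φ} k {y c} → slot k ≡ just y → Available φ y c → AvailableAt φ (slot k) c
      back {φ} k {c = c} eq = subst (λ s → AvailableAt φ s c) (sym eq)

      apart : ∀ k k' {y y'} → slot k ≡ just y → slot k' ≡ just y' → k ≢ k' → y ≢ y'
      apart k k' eq eq' k≢k' refl = k≢k' (slot-injective {k = k} {k'} eq eq')

      open KempeChain (Edge? S) Edge-sym Edge-irrefl proper α≢β (proj₁ (at 0F eq₀ (α∈ 0F)))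

      j≢α : j ≢ α
      j≢α = α≢j ∘ sym
      j≢β : j ≢ β
      j≢β = β≢j ∘ sym

      kempe-admissible : Admissible S kempe
      kempe-admissible = record
        { proper = kempe-proper
        ; w-misses-j = λ q Ewq → w-misses-j q Ewq ∘ to (kempe-≡-other j≢α j≢β w q)
        ; uv≡j⇔i≡j = ⇔-trans (kempe-≡-other j≢α j≢β u v) uv≡j⇔i≡j
        }

      first : AvailableAt kempe (slot 0F) β
      first = back 0F eq₀ (start-misses-b , λ _ → β≢j)

      stays-α : ∀ k {y} → slot k ≡ just y → ¬ InChain y → AvailableAt kempe (slot k) α
      stays-α k eq y∉ =
        let misses , not-j = at k eq (α∈ k) in back k eq (misses-kempe-outside y∉ misses , not-j)

      stays-γ : ∀ k {y} → slot k ≡ just y → AvailableAt φ (slot k) γ → AvailableAt kempe (slot k) γ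
      stays-γ k eq γ∈ =
        let misses , not-j = at k eq γ∈ in back k eq (misses-kempe-other γ≢α γ≢β misses , not-j)

      representatives : Dec (InChain x₁) → DistinctRepresentatives (AvailableAt kempe ∘ slot)
      representatives (no x₁∉) =
        distinct-triple {P = AvailableAt kempe ∘ slot} (α≢β ∘ sym) (γ≢β ∘ sym) (γ≢α ∘ sym)
          first (stays-α 1F eq₁ x₁∉) (stays-γ 2F eq₂ γ∈₂)
      representatives (yes x₁∈) =
        distinct-triple {P = AvailableAt kempe ∘ slot} (γ≢β ∘ sym) (α≢β ∘ sym) γ≢α
          first (stays-γ 1F eq₁ γ∈₁) (stays-α 2F eq₂ x₂∉)
        where
        x₂∉ : ¬ InChain x₂
        x₂∉ x₂∈ = apart 1F 2F eq₁ eq₂ (λ ()) (chain-end-unique x₁∈ x₂∈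
          (apart 1F 0F eq₁ eq₀ (λ ())) (apart 2F 0F eq₂ eq₀ (λ ()))
          (proj₁ (at 1F eq₁ (α∈ 1F))) (proj₁ (at 2F eq₂ (α∈ 2F))))

    insert : Admissible S φ → ∃ (Admissible (S ∪ ⁅ z ⁆))
    insert {φ} adm with representatives-or-blocked (λ k → available? φ (slot k)) ≤-refl
                          (first-slot-available φ) (later-slot-available φ 1F λ ()) (later-slot-available φ 2F λ ())
    ... | inj₁ reps = extend-by-representatives adm reps
    ... | inj₂ blocked with unblock adm blocked
    ...   | φ' , adm' , reps' = extend-by-representatives adm' reps'

  Reached : List (Fin n) → Subset n
  Reached [] = S₀
  Reached (z ∷ zs) = Reached zs ∪ ⁅ z ⁆

  S₀⊆Reached : ∀ zs → S₀ ⊆ Reached zs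
  S₀⊆Reached [] = id
  S₀⊆Reached (z ∷ zs) = p⊆p∪q ⁅ z ⁆ ∘ S₀⊆Reached zs

  ∈⇒∈Reached : ∀ {zs} → y ∈ zs → y ∈ₛ Reached zs
  ∈⇒∈Reached {zs = z ∷ zs} (here refl) = q⊆p∪q (Reached zs) ⁅ z ⁆ (x∈⁅x⁆ z)
  ∈⇒∈Reached {zs = z ∷ zs} (there y∈) = p⊆p∪q ⁅ z ⁆ (∈⇒∈Reached y∈)

  admissible-on : ∀ zs → ∃ (Admissible (Reached zs))
  admissible-on [] = base
  admissible-on (z ∷ zs) with admissible-on zs | z ∈? Reached zs
  ... | φ , adm | yes z∈ = φ , admissible-⊆ absorb adm
    where
    absorb : Reached zs ∪ ⁅ z ⁆ ⊆ Reached zs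
    absorb y∈ with x∈p∪q⁻ (Reached zs) ⁅ z ⁆ y∈
    ... | inj₁ y∈zs = y∈zs
    ... | inj₂ y∈z rewrite x∈⁅y⁆⇒x≡y z y∈z = z∈
  ... | φ , adm | no z∉ =
    Insert.insert z∉ (S₀⊆Reached zs u∈S₀) (S₀⊆Reached zs v∈S₀) (S₀⊆Reached zs w∈S₀) adm

  -- Renaming φ u v to i keeps j missing at w: if i ≡ j the renaming is
  -- trivial, and otherwise it fixes j.
  constrained-colouring : ∃ λ ψ → IsProper (Adj G) ψ × ψ u v ≡ i × Misses (Adj G) ψ w j
  constrained-colouring with admissible-on (allFin n)
  ... | φ , adm = ψ , ψ-proper , transpose-matchˡ (φ u v) i , ψ-w-misses-j
    where
    open Admissible adm
    open IsProper proper

    everywhere : Adj G p q → Edge (Reached (allFin n)) p q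
    everywhere {p} {q} Apq = Apq , ∈⇒∈Reached (∈-allFin p) , ∈⇒∈Reached (∈-allFin q)

    ψ : Fin n → Fin n → Colour
    ψ p q = transpose (φ u v) i (φ p q)

    ψ-proper : IsProper (Adj G) ψ
    ψ-proper = record
      { symmetric = cong (transpose (φ u v) i) ∘ symmetric ∘ everywhere
      ; distinct = λ Apq Apr q≢r →
          distinct (everywhere Apq) (everywhere Apr) q≢r ∘ transpose-injective (φ u v) i
      }

    ψ-w-misses-j : Misses (Adj G) ψ w j
    ψ-w-misses-j q Awq ψwq≡j = w-misses-j q (everywhere Awq) (φwq≡j (i ≟ j))
      where
      φwq≡j : Dec (i ≡ j) → φ w q ≡ j
      φwq≡j (yes refl) = begin
        φ w q  ≡⟨ transpose-injective (φ u v) i (trans ψwq≡j (sym (transpose-matchˡ (φ u v) i))) ⟩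
        φ u v  ≡⟨ from uv≡j⇔i≡j refl ⟩
        i      ∎
        where open ≡-Reasoning
      φwq≡j (no i≢j) = to (transpose-≡-other (i≢j ∘ to uv≡j⇔i≡j ∘ sym) (i≢j ∘ sym) (φ w q)) ψwq≡j

Fin2-≢-unique : {p q r : Fin 2} → p ≢ q → p ≢ r → q ≡ r
Fin2-≢-unique {0F} {0F} p≢q _ = contradiction refl p≢q
Fin2-≢-unique {0F} {1F} {0F} _ p≢r = contradiction refl p≢r
Fin2-≢-unique {0F} {1F} {1F} _ _ = refl
Fin2-≢-unique {1F} {0F} {0F} _ _ = refl
Fin2-≢-unique {1F} {0F} {1F} _ p≢r = contradiction refl p≢r
Fin2-≢-unique {1F} {1F} p≢q _ = contradiction refl p≢q

module _ {n} (G : Graph n) where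

  □K₂-edge : ∀ p₁ p₂ q₁ q₂ → T (□K₂adj G (p₁ , p₂) (q₁ , q₂)) →
             (p₁ ≡ q₁ × p₂ ≢ q₂) ⊎ (p₂ ≡ q₂ × Adj G p₁ q₁)
  □K₂-edge p₁ p₂ q₁ q₂ e with to (T-∨ {⌊ p₁ ≟ q₁ ⌋ ∧ K₂adj p₂ q₂}) e
  ... | inj₁ rung =
    let same , differ = to (T-∧ {⌊ p₁ ≟ q₁ ⌋}) rung in inj₁ (toWitness same , toWitnessFalse differ)
  ... | inj₂ layer =
    let same , Apq = to (T-∧ {⌊ p₂ ≟ q₂ ⌋}) layer in inj₂ (toWitness same , Apq)

  lift : ∀ {k} → (Fin n → Fin n → Fin k) → (Fin n → Fin k) → Fin n × Fin 2 → Fin n × Fin 2 → Fin k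
  lift ψ ρ (p , _) (q , _) with p ≟ q
  ... | yes _ = ρ p
  ... | no _ = ψ p q

  module _ {k} {ψ : Fin n → Fin n → Fin k} {ρ : Fin n → Fin k} where

    lift-rung : ∀ {p q s t} → p ≡ q → lift ψ ρ (p , s) (q , t) ≡ ρ p
    lift-rung {p} {q} p≡q with p ≟ q
    ... | yes _ = refl
    ... | no p≢q = contradiction p≡q p≢q

    lift-layer : ∀ {p q s t} → p ≢ q → lift ψ ρ (p , s) (q , t) ≡ ψ p q
    lift-layer {p} {q} p≢q with p ≟ q
    ... | yes p≡q = contradiction p≡q p≢q
    ... | no _ = refl

    lift-proper : IsProper (Adj G) ψ → (∀ p → Misses (Adj G) ψ p (ρ p)) →
                  IsProperEdgeColouring (□K₂adj G) k (lift ψ ρ)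
    lift-proper ψ-proper ρ-missing = lift-symmetric , lift-distinct
      where
      open IsProper ψ-proper

      lift-symmetric : ∀ x y → T (□K₂adj G x y) → lift ψ ρ x y ≡ lift ψ ρ y x
      lift-symmetric (p , s) (q , t) e with □K₂-edge p s q t e
      ... | inj₁ (refl , _) = trans (lift-rung {p} {p} {s} {t} refl) (sym (lift-rung {p} {p} {t} {s} refl))
      ... | inj₂ (_ , Apq) =
        trans (lift-layer {p} {q} {s} {t} (Adj⇒≢ G Apq))
              (trans (symmetric Apq) (sym (lift-layer {q} {p} {t} {s} (Adj⇒≢ G Apq ∘ sym))))

      lift-distinct : ∀ x y z → T (□K₂adj G x y) → T (□K₂adj G x z) → y ≢ z →
                      lift ψ ρ x y ≢ lift ψ ρ x z
      lift-distinct (p , s) (q , t) (r , t') exy exz y≢z with □K₂-edge p s q t exy | □K₂-edge p s r t' exz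
      ... | inj₁ (refl , s≢t) | inj₁ (refl , s≢t') =
        contradiction (cong (p ,_) (Fin2-≢-unique s≢t s≢t')) y≢z
      ... | inj₁ (refl , _) | inj₂ (_ , Apr)
        rewrite lift-rung {p} {p} {s} {t} refl | lift-layer {p} {r} {s} {t'} (Adj⇒≢ G Apr) =
        ρ-missing p r Apr ∘ sym
      ... | inj₂ (_ , Apq) | inj₁ (refl , _)
        rewrite lift-layer {p} {q} {s} {t} (Adj⇒≢ G Apq) | lift-rung {p} {p} {s} {t'} refl =
        ρ-missing p q Apq
      ... | inj₂ (refl , Apq) | inj₂ (refl , Apr)
        rewrite lift-layer {p} {q} {s} {s} (Adj⇒≢ G Apq) | lift-layer {p} {r} {s} {s} (Adj⇒≢ G Apr) =
        distinct Apq Apr (y≢z ∘ cong (_, s))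

  missing-colour : Subcubic G → ∀ (ψ : Fin n → Fin n → Colour) p → ∃ (Misses (Adj G) ψ p)
  missing-colour subcubic ψ p with ∃-∉ (map (ψ p) (neighbours G p)) (s≤s few)
    where
    few : length (map (ψ p) (neighbours G p)) ≤ 3
    few rewrite length-map (ψ p) (neighbours G p) | length-neighbours G p = subcubic p
  ... | c , c∉ = c , λ { q Apq refl → c∉ (∈-map⁺ (ψ p) (from (∈-neighbours G) Apq)) }

  rung-colours : Subcubic G → ∀ {ψ : Fin n → Fin n → Colour} {w j} → Misses (Adj G) ψ w j →
                 ∃ λ ρ → ρ w ≡ j × ∀ p → Misses (Adj G) ψ p (ρ p)
  rung-colours subcubic {ψ} {w} {j} w-misses-j = ρ , ρ-w , ρ-missing
    where
    ρ : Fin n → Colour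
    ρ p with p ≟ w
    ... | yes _ = j
    ... | no _ = proj₁ (missing-colour subcubic ψ p)
    ρ-w : ρ w ≡ j
    ρ-w with w ≟ w
    ... | yes _ = refl
    ... | no w≢w = contradiction refl w≢w
    ρ-missing : ∀ p → Misses (Adj G) ψ p (ρ p)
    ρ-missing p with p ≟ w
    ... | yes refl = w-misses-j
    ... | no _ = proj₂ (missing-colour subcubic ψ p)

□K₂-extension : ∀ {n} (G : Graph n) → Subcubic G → ∀ {u v} → Adj G u v → ∀ w {i j : Colour} →
                (w ≡ u ⊎ w ≡ v → i ≢ j) →
                Σ (Fin n × Fin 2 → Fin n × Fin 2 → Colour) λ c →
                  IsProperEdgeColouring (□K₂adj G) 4 c × c (u , a) (v , a) ≡ i × c (w , a) (w , b) ≡ j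
□K₂-extension G subcubic uv w i≢j-at-w
  with Construction.constrained-colouring G subcubic uv w i≢j-at-w
... | ψ , ψ-proper , ψuv≡i , w-misses-j with rung-colours G subcubic w-misses-j
...   | ρ , ρw≡j , ρ-missing =
  lift G ψ ρ , lift-proper G ψ-proper ρ-missing ,
  trans (lift-layer G {s = a} {t = a} (Adj⇒≢ G uv)) ψuv≡i ,
  trans (lift-rung G {p = w} {q = w} {s = a} {t = b} refl) ρw≡j

Agrees : {C : Set} → Maybe C → C → Set
Agrees m c = ∀ c' → m ≡ just c' → c ≡ c'

complete-precolouring : {P : Set} (cₑ c_f : Maybe Colour) →
  (P → ∀ i j → cₑ ≡ just i → c_f ≡ just j → i ≢ j) →
  ∃₂ λ i j → (P → i ≢ j) × Agrees cₑ i × Agrees c_f j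
complete-precolouring (just i) (just j) compatible =
  i , j , (λ p → compatible p i j refl refl) , (λ { _ refl → refl }) , λ { _ refl → refl }
complete-precolouring (just i) nothing _ =
  let j , j∉ = ∃-∉ (i ∷ []) (s≤s (s≤s z≤n))
  in i , j , (λ _ → j∉ ∘ here ∘ sym) , (λ { _ refl → refl }) , λ _ ()
complete-precolouring nothing (just j) _ =
  let i , i∉ = ∃-∉ (j ∷ []) (s≤s (s≤s z≤n))
  in i , j , (λ _ → i∉ ∘ here) , (λ _ ()) , λ { _ refl → refl }
complete-precolouring nothing nothing _ = 0F , 1F , (λ _ ()) , (λ _ ()) , λ _ ()

lemma3 : (n : ℕ) (G : Graph n) → Subcubic G →
         (u v w : Fin n) → Adj G u v →
         -- partial colouring of {e_a, f}: nothing = uncoloured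
         (cₑ c_f : Maybe (Fin 4)) →
         -- properness: e_a and f are adjacent iff w ∈ {u, v}
         ((w ≡ u ⊎ w ≡ v) → ∀ i j → cₑ ≡ just i → c_f ≡ just j → i ≢ j) →
         Σ (Fin n × Fin 2 → Fin n × Fin 2 → Fin 4) λ c →
           IsProperEdgeColouring (□K₂adj G) 4 c ×
           (∀ i → cₑ ≡ just i → c (u , a) (v , a) ≡ i) ×
           (∀ j → c_f ≡ just j → c (w , a) (w , b) ≡ j)
lemma3 n G subcubic u v w uv cₑ c_f compatible with complete-precolouring cₑ c_f compatible
... | i , j , i≢j-at-w , i-agrees , j-agrees with □K₂-extension G subcubic uv w i≢j-at-w
...   | c , c-proper , cₑ≡i , c_f≡j =
  c , c-proper , (λ i' eq → trans cₑ≡i (i-agrees i' eq)) , λ j' eq → trans c_f≡j (j-agrees j' eq)
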